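{- Let $m \ge 4$ be even and $k \in \{2, 4, \ldots, m-2\}$. Let $\mathcal{P}_{m,k} = \{ p \text{ prime} : (p-1) \mid k \text{ and } p \nmid \binom{m}{k}\}$. Then $$\max(\mathcal{P}_{m,k}) \le \min\!\left(k+1, \frac{m+1}{3}\right),$$ with the convention $\max(\emptyset) = 0$. -}

module Defs where

open import Data.Nat using (ℕ; _∸_)
open import Data.Nat.Divisibility using (_∣_)
open import Data.Nat.Primality using (Prime)
open import Data.Nat.Combinatorics using (_C_)
open import Data.Product using (_×_)
open import Relation.Nullary using (¬_)

InP : ℕ → ℕ → ℕ → Set
InP m k p = Prime p × ((p ∸ 1) ∣ k) × ¬ (p ∣ (m C k))

{-# OPTIONS --safe #-}
module Submission where

-- If p ∤ j! and p divides one of the j factors m, m − 1, …, m − j + 1 of the falling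
-- factorial m!/(m − j)! = C(m,j) · j!, then p ∣ C(m,j).  Suppose 3p ≥ m + 2.  For p = 2
-- this forces m = 4, k = 2.  For odd p write k = c(p − 1): c ≥ 3 leaves no room for
-- k ≤ m − 2; for c = 1 the window of k = p − 1 factors contains p or 2p; for c = 2 the
-- window of C(m, m − k) contains 2p, with m − k < p because m is even.  The cases
-- missed by the windows are exactly those where m would be odd.

open import Defs
open import Data.Nat
open import Data.Nat.Properties
open import Data.Nat.Divisibility
open import Data.Nat.DivMod using (_/_; m/n*n≡m)
open import Data.Nat.Primality using (Prime; euclidsLemma; prime⇒nonTrivial; prime⇒irreducible)
open import Data.Nat.Combinatorics using (_C_; _P_; nCk≡nPk/k!; nPk≡n!/[n∸k]!; nCk≡nC[n∸k])
open import Data.Nat.Combinatorics.Base using (_P′_)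
open import Data.Nat.Combinatorics.Specification using (k!∣nP′k; nP′k≡n!/[n∸k]!)
open import Data.Nat.Tactic.RingSolver using (solve-∀)
open import Data.Product using (_×_; _,_)
open import Data.Sum using (inj₁; inj₂)
open import Data.Empty using (⊥-elim)
open import Relation.Binary.Definitions using (tri<; tri≈; tri>)
open import Relation.Binary.PropositionalEquality
open import Relation.Nullary using (¬_; yes; no)

private
  variable
    m n p i j k q : ℕ

m∸1∣n⇒m≤n+1 : (m ∸ 1) ∣ n → .{{NonZero n}} → m ≤ n + 1
m∸1∣n⇒m≤n+1 {m} {n} m∸1∣n = begin
  m             ≤⟨ m≤n+m∸n m 1 ⟩
  1 + (m ∸ 1)   ≤⟨ s≤s (∣⇒≤ m∸1∣n) ⟩
  1 + n         ≡⟨ +-comm 1 n ⟩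
  n + 1         ∎
  where open ≤-Reasoning

nCk*k!≡nP′k : k ≤ n → (n C k) * k ! ≡ n P′ k
nCk*k!≡nP′k {k} {n} k≤n = begin
  (n C k) * k !         ≡⟨ cong (_* k !) (nCk≡nPk/k! k≤n) ⟩
  (n P k) / k ! * k !   ≡⟨ cong (λ x → x / k ! * k !) (trans (nPk≡n!/[n∸k]! k≤n) (sym (nP′k≡n!/[n∸k]! k≤n))) ⟩
  (n P′ k) / k ! * k !  ≡⟨ m/n*n≡m (k!∣nP′k k≤n) ⟩
  n P′ k                ∎
  where
    open ≡-Reasoning
    instance _ = k !≢0

∣n∸i⇒∣nP′k : i < k → p ∣ n ∸ i → p ∣ n P′ k
∣n∸i⇒∣nP′k {i} {suc k} {n = n} (s≤s i≤k) p∣n∸i with m≤n⇒m<n∨m≡n i≤k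
... | inj₁ i<k  = ∣-trans (∣n∸i⇒∣nP′k i<k p∣n∸i) (n∣m*n (n ∸ k))
... | inj₂ refl = ∣-trans p∣n∸i (m∣m*n (n P′ i))

prime∤n! : Prime p → n < p → ¬ p ∣ n !
prime∤n! {n = zero}  pp _   p∣1   = nonTrivial⇒≢1 {{prime⇒nonTrivial pp}} (∣1⇒≡1 p∣1)
prime∤n! {n = suc n} pp n<p p∣n! with euclidsLemma (suc n) (n !) pp p∣n!
... | inj₁ p∣1+n = <⇒≱ n<p (∣⇒≤ p∣1+n)
... | inj₂ p∣n!  = prime∤n! pp (<-trans (n<1+n n) n<p) p∣n!

prime∣nCk : Prime p → k ≤ n → k < p → i < k → n ≡ m * p + i → p ∣ n C k
prime∣nCk {p} {k} {n} {i} {m} pp k≤n k<p i<k n≡mp+i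
  with euclidsLemma (n C k) (k !) pp (subst (p ∣_) (sym (nCk*k!≡nP′k k≤n)) (∣n∸i⇒∣nP′k i<k p∣n∸i))
  where
    p∣n∸i : p ∣ n ∸ i
    p∣n∸i = subst (p ∣_) (sym (trans (cong (_∸ i) n≡mp+i) (m+n∸n≡m (m * p) i))) (n∣m*n m)
... | inj₁ p∣nCk = p∣nCk
... | inj₂ p∣k!  = ⊥-elim (prime∤n! pp k<p p∣k!)

2∤2n+1 : ∀ n → ¬ 2 ∣ 2 * n + 1
2∤2n+1 n 2∣2n+1 with ∣1⇒≡1 (∣m+n∣m⇒∣n 2∣2n+1 (m∣m*n n))
... | ()

prime>2⇒odd : Prime p → 2 < p → ¬ 2 ∣ p
prime>2⇒odd pp 2<p 2∣p with prime⇒irreducible pp 2∣p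
... | inj₂ refl = <-irrefl refl 2<p

module OddPrime (pp : Prime (suc q)) (p-odd : ¬ 2 ∣ suc q) where

  prime∣C-k≡p∸1 : k ≡ q → 2 ≤ j → 2 ∣ k + j → j ≤ 2 * q + 1 → suc q ∣ (k + j) C k
  prime∣C-k≡p∸1 {j = j@(suc i)} refl (s≤s _) 2∣m j≤2q+1 with <-cmp j (suc q)
  ... | tri< (s≤s i<q) _ _ = prime∣nCk {m = 1} pp (m≤m+n q j) (n<1+n q) i<q (window-p q i)
    where
      window-p : ∀ q i → q + suc i ≡ 1 * suc q + i
      window-p = solve-∀
  ... | tri≈ _ refl _ = ⊥-elim (2∤2n+1 q (subst (2 ∣_) (odd-sum q) 2∣m))
    where
      odd-sum : ∀ q → q + suc q ≡ 2 * q + 1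
      odd-sum = solve-∀
  ... | tri> _ _ p<j with m≤n⇒∃[o]m+o≡n p<j
  ...   | e , refl = prime∣nCk {m = 2} pp (m≤m+n q j) (n<1+n q) e<q (window-2p q e)
    where
      window-2p : ∀ q e → q + (suc (suc q) + e) ≡ 2 * suc q + e
      window-2p = solve-∀
      shift : ∀ q e → suc (suc q) + e ≡ suc q + suc e
      shift = solve-∀
      split : ∀ q → 2 * q + 1 ≡ suc q + q
      split = solve-∀
      e<q : e < q
      e<q = +-cancelˡ-≤ (suc q) (suc e) q (subst₂ _≤_ (shift q e) (split q) j≤2q+1)

  prime∣C-k≡2[p∸1] : k ≡ 2 * q → 2 ≤ j → 2 ∣ k + j → j ≤ suc q → suc q ∣ (k + j) C k
  prime∣C-k≡2[p∸1] {j = j@(suc (suc i))} refl (s≤s (s≤s _)) 2∣m j≤p with m≤n⇒m<n∨m≡n j≤p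
  ... | inj₂ refl = ⊥-elim (p-odd (∣m+n∣m⇒∣n 2∣m (m∣m*n q)))
  ... | inj₁ j<p = subst (suc q ∣_) (sym (C-symmetric (2 * q) j))
                     (prime∣nCk {m = 2} pp (m≤n+m j (2 * q)) j<p (m<n+m i z<s) (window-2p q i))
    where
      C-symmetric : ∀ k j → (k + j) C k ≡ (k + j) C j
      C-symmetric k j = trans (nCk≡nC[n∸k] (m≤m+n k j)) (cong ((k + j) C_) (m+n∸m≡n k j))
      window-2p : ∀ q i → 2 * q + suc (suc i) ≡ 2 * suc q + i
      window-2p = solve-∀

  prime∣C-multiple : ∀ c → 2 ≤ c * q → 2 ≤ j → 2 ∣ c * q + j → c * q + j ≤ 3 * q + 1 →
                     suc q ∣ (c * q + j) C (c * q)
  prime∣C-multiple 0 ()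
  prime∣C-multiple {j = j} 1 _ 2≤j 2∣m m≤3q+1 =
    prime∣C-k≡p∸1 (*-identityˡ q) 2≤j 2∣m
      (+-cancelˡ-≤ (1 * q) j (2 * q + 1) (subst (1 * q + j ≤_) (split q) m≤3q+1))
    where
      split : ∀ q → 3 * q + 1 ≡ 1 * q + (2 * q + 1)
      split = solve-∀
  prime∣C-multiple {j = j} 2 _ 2≤j 2∣m m≤3q+1 =
    prime∣C-k≡2[p∸1] refl 2≤j 2∣m (+-cancelˡ-≤ (2 * q) j (suc q) (subst (2 * q + j ≤_) (split q) m≤3q+1))
    where
      split : ∀ q → 3 * q + 1 ≡ 2 * q + suc q
      split = solve-∀
  prime∣C-multiple {j = j} c@(suc (suc (suc _))) _ 2≤j _ m≤3q+1 = ⊥-elim (<⇒≱ 2≤j j≤1)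
    where
      j≤1 : j ≤ 1
      j≤1 = +-cancelˡ-≤ (3 * q) j 1 (≤-trans (+-monoˡ-≤ j (*-monoˡ-≤ q {3} {c} (s≤s (s≤s (s≤s z≤n))))) m≤3q+1)

prime∣C-of-3p>m+1 : Prime p → (p ∸ 1) ∣ k → 2 ≤ k → k + 2 ≤ m → 2 ∣ m → m + 1 < 3 * p → p ∣ m C k
prime∣C-of-3p>m+1 {0} pp = ⊥-elim (<⇒≱ (nonTrivial⇒n>1 0 {{prime⇒nonTrivial pp}}) z≤n)
prime∣C-of-3p>m+1 {1} pp = ⊥-elim (<-irrefl refl (nonTrivial⇒n>1 1 {{prime⇒nonTrivial pp}}))
prime∣C-of-3p>m+1 {2} {k} {m} _ _ 2≤k k+2≤m _ (s≤s m+1≤5)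
  with refl ← ≤-antisym (+-cancelʳ-≤ 1 m 4 m+1≤5) (≤-trans (+-monoˡ-≤ 2 2≤k) k+2≤m)
  with refl ← ≤-antisym (+-cancelʳ-≤ 2 k 2 k+2≤m) 2≤k
  = divides 3 refl
prime∣C-of-3p>m+1 {p@(suc q@(suc (suc s)))} {m = m} pp (divides c refl) 2≤k k+2≤m 2∣m m+1<3p
  with m≤n⇒∃[o]m+o≡n (m+n≤o⇒m≤o (c * q) k+2≤m)
... | j , refl = prime∣C-multiple c 2≤k 2≤j 2∣m m≤3q+1
  where
    open OddPrime pp (prime>2⇒odd pp (s≤s (s≤s (s≤s z≤n))))
    2≤j : 2 ≤ j
    2≤j = +-cancelˡ-≤ (c * q) 2 j k+2≤m
    3[1+q]≡3q+1+2 : ∀ q → 3 * suc q ≡ suc (3 * q + 1 + 1)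
    3[1+q]≡3q+1+2 = solve-∀
    m≤3q+1 : m ≤ 3 * q + 1
    m≤3q+1 = +-cancelʳ-≤ 1 m (3 * q + 1) (s≤s⁻¹ (subst (suc (m + 1) ≤_) (3[1+q]≡3q+1+2 q) m+1<3p))

lemma5 : (m k : ℕ) → 4 ≤ m → 2 ∣ m → 2 ∣ k → 2 ≤ k → k ≤ m ∸ 2 →
    (p : ℕ) → InP m k p → (p ≤ k + 1) × (3 * p ≤ m + 1)
lemma5 m k 4≤m 2∣m _ 2≤k k≤m∸2 p (pp , p∸1∣k , p∤mCk) =
  m∸1∣n⇒m≤n+1 p∸1∣k {{>-nonZero (<⇒≤ 2≤k)}} , 3p≤m+1
  where
    3p≤m+1 : 3 * p ≤ m + 1
    3p≤m+1 with 3 * p ≤? m + 1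
    ... | yes 3p≤m+1 = 3p≤m+1
    ... | no  3p≰m+1 = ⊥-elim (p∤mCk (prime∣C-of-3p>m+1 pp p∸1∣k 2≤k
                          (m≤o∸n⇒m+n≤o k (m+n≤o⇒n≤o 2 4≤m) k≤m∸2) 2∣m (≰⇒> 3p≰m+1)))
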